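{- Let $p$ be a prime such that $2$ is a primitive root modulo $p$. Then for every natural number $x$, $$S_p(2^p x) = p\, S_p(2x).$$
   Context: For $m, x \in \mathbb{N}$, the Newman sum is $S_m(x)=\sum_{0\le n<x,\ n\equiv 0 \pmod m} (-1)^{\sigma(n)}$, where $\sigma(n)$ denotes the number of 1's in the binary expansion of $n$. -}

module Defs where

open import Data.Nat using (ℕ; zero; suc; _+_; _*_; _∸_; _^_; _<_; _%_; _/_)
open import Data.Nat.Primality using (Prime)
open import Data.Integer using (ℤ; +_; -_) renaming (_+_ to _+ℤ_)
open import Data.Bool using (Bool; true; false; if_then_else_)
open import Data.Nat using (_≡ᵇ_)
open import Relation.Binary.PropositionalEquality using (_≡_; _≢_)
open import Data.Product using (_×_)
open import Data.Nat.Divisibility using (_∣_; _∣?_)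
open import Relation.Nullary using (¬_; does)

-- number of 1's in binary expansion, computed with fuel (fuel n suffices for n)
σ-fuel : ℕ → ℕ → ℕ
σ-fuel zero    n = 0
σ-fuel (suc f) zero = 0
σ-fuel (suc f) n = (n % 2) + σ-fuel f (n / 2)

σ : ℕ → ℕ
σ n = σ-fuel n n

neg1^ : ℕ → ℤ
neg1^ zero = + 1
neg1^ (suc k) = - neg1^ k

sumBelow : ℕ → (ℕ → ℤ) → ℤ
sumBelow zero    f = + 0
sumBelow (suc x) f = sumBelow x f +ℤ f x

S : ℕ → ℕ → ℤ
S m x = sumBelow x (λ n → if does (m ∣? n) then neg1^ (σ n) else + 0)

IsPrimitiveRoot2 : ℕ → Set
IsPrimitiveRoot2 p = (p ∣ (2 ^ (p ∸ 1) ∸ 1))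
  × (∀ k → 0 < k → k < p ∸ 1 → ¬ (p ∣ (2 ^ k ∸ 1)))

{-# OPTIONS --safe #-}

-- Let tm = (-1)^σ be the Thue–Morse sign, δ the indicator of multiples of p, and E the shift
-- (E φ) m = φ (m + 1). Since tm (2^j q + r) = tm q · tm r for r < 2^j, the block [2^p x, 2^p (x + 1))
-- of S_p contributes tm x · (∏_{i<p} (1 - E^(2^i)) δ) (2^p x). As 2 is a primitive root, the
-- exponents 2^i (i < p) run modulo p through 1, 1, 2, …, p - 1, and ∏_{k=1}^{p-1} (1 - E^k) acts
-- on δ as multiplication by p up to an additive constant (the operator form of
-- ∏_{k=1}^{p-1} (1 - ζ^k) = p). To see this, expand the product through the elementary symmetric
-- polynomials e_s of the E^k: the e_s of all shifts E^0, …, E^(p-1) is invariant under E^s, hence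
-- under E as p is prime, so e_s(E^1, …, E^(p-1)) δ is the constant minus e_(s-1)(E^1, …, E^(p-1)) δ.
-- The block therefore equals p · tm x · (δ (2x) - δ (2x + 1)) (using 2^p ≡ 2), which is p times the
-- block [2x, 2x + 2) of S_p, and induction on x concludes.

module Submission where

open import Defs
open import Data.Nat using (ℕ; zero; suc; _+_; _*_; _∸_; _^_; _≤_; _<_; z≤n; s≤s; NonZero; _%_; _/_; nonTrivial⇒n>1; nonTrivial⇒≢1)
open import Data.Nat.Properties
open import Data.Nat.DivMod using (m≡m%n+[m/n]*n; n%n≡0; %-remove-+ˡ; m%n<n; m*n/n≡m; [m+kn]%n≡m%n; +-distrib-/-∣ʳ; m/n<m; m<n*o⇒m/o<n; m<n⇒m%n≡m; m<n⇒m/n≡0)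
open import Data.Nat.Divisibility using (_∣_; _∣?_; divides; n∣m*n; m∣m*n; ∣-trans; ∣1⇒≡1; m%n≡0⇒n∣m; ∣-refl; ∣m∣n⇒∣m+n; ∣m+n∣m⇒∣n)
open import Data.Nat.Primality using (Prime; prime⇒nonTrivial; euclidsLemma; ¬prime[0])
open import Data.Nat.Coprimality using (Coprime; coprime-Bézout; prime⇒coprime)
open import Data.Nat.GCD using (module Bézout)
open import Data.Integer using (ℤ; +_; -_) renaming (_+_ to _+ℤ_; _-_ to _-ℤ_; _*_ to _*ℤ_)
import Data.Integer.Properties as ℤ
import Algebra.Properties.CommutativeSemigroup as CommSemigroupProperties
open import Data.Integer.Tactic.RingSolver using (solve-∀)
import Data.Nat.Tactic.RingSolver as ℕ-Solver
open import Data.List using (List; []; _∷_; _∷ʳ_; _++_; [_]; length; map; applyDownFrom; downFrom)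
open import Data.List.Properties using (length-map; length-applyDownFrom; map-applyDownFrom; map-downFrom; downFrom-∷ʳ)
open import Data.List.Relation.Binary.Permutation.Propositional as ↭ using (_↭_)
open import Data.List.Relation.Binary.Permutation.Propositional.Properties using (↭-length; ∷↭∷ʳ; shift)
open import Data.List.Relation.Unary.All as All using (All; []; _∷_)
open import Data.List.Relation.Unary.Any using (here; there)
open import Data.List.Relation.Unary.AllPairs using ([]; _∷_)
open import Data.List.Relation.Unary.Unique.Propositional using (Unique)
import Data.List.Relation.Unary.Unique.Propositional.Properties as Uniqueₚ
import Data.List.Relation.Unary.All.Properties as Allₚ
open import Data.List.Membership.Propositional using (_∈_)
open import Data.List.Membership.Propositional.Properties using (∈-applyDownFrom⁺; ∈-∃++; ∈-++⁻; ∈-++⁺ˡ; ∈-++⁺ʳ)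
open import Data.Product using (_×_; _,_)
open import Data.Sum using (inj₁; inj₂)
open import Data.Bool using (if_then_else_)
open import Relation.Nullary using (¬_; does; yes; no; contradiction)
open import Relation.Binary.PropositionalEquality using (_≡_; _≢_; refl; cong; cong₂; sym; trans; subst; module ≡-Reasoning)

module ℕ+ = CommSemigroupProperties +-commutativeSemigroup
module ℤ+ = CommSemigroupProperties ℤ.+-commutativeSemigroup
module ℤ* = CommSemigroupProperties ℤ.*-commutativeSemigroup

sumBelow-cong : ∀ n {f g : ℕ → ℤ} → (∀ i → i < n → f i ≡ g i) → sumBelow n f ≡ sumBelow n g
sumBelow-cong zero    f≗g = refl
sumBelow-cong (suc n) f≗g =
  cong₂ _+ℤ_ (sumBelow-cong n (λ i i<n → f≗g i (m<n⇒m<1+n i<n))) (f≗g n (n<1+n n))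

sumBelow-suc : ∀ n (f : ℕ → ℤ) → sumBelow (suc n) f ≡ f 0 +ℤ sumBelow n (λ i → f (suc i))
sumBelow-suc zero    f = trans (ℤ.+-identityˡ (f 0)) (sym (ℤ.+-identityʳ (f 0)))
sumBelow-suc (suc n) f = trans (cong (_+ℤ f (suc n)) (sumBelow-suc n f)) (ℤ.+-assoc (f 0) _ _)

sumBelow-+ : ∀ a b (f : ℕ → ℤ) → sumBelow (a + b) f ≡ sumBelow a f +ℤ sumBelow b (λ i → f (a + i))
sumBelow-+ a zero    f = trans (cong (λ n → sumBelow n f) (+-identityʳ a)) (sym (ℤ.+-identityʳ _))
sumBelow-+ a (suc b) f = begin
  sumBelow (a + suc b) f                                  ≡⟨ cong (λ n → sumBelow n f) (+-suc a b) ⟩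
  sumBelow (a + b) f +ℤ f (a + b)                         ≡⟨ cong (_+ℤ f (a + b)) (sumBelow-+ a b f) ⟩
  sumBelow a f +ℤ sumBelow b (λ i → f (a + i)) +ℤ f (a + b) ≡⟨ ℤ.+-assoc (sumBelow a f) _ _ ⟩
  sumBelow a f +ℤ sumBelow (suc b) (λ i → f (a + i))      ∎
  where open ≡-Reasoning

sumBelow-neg : ∀ n (f : ℕ → ℤ) → sumBelow n (λ i → - f i) ≡ - sumBelow n f
sumBelow-neg zero    f = refl
sumBelow-neg (suc n) f =
  trans (cong (_+ℤ - f n) (sumBelow-neg n f)) (sym (ℤ.neg-distrib-+ (sumBelow n f) (f n)))

sumBelow-- : ∀ n (f g : ℕ → ℤ) → sumBelow n (λ i → f i -ℤ g i) ≡ sumBelow n f -ℤ sumBelow n g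
sumBelow-- zero    f g = refl
sumBelow-- (suc n) f g =
  trans (cong (_+ℤ (f n -ℤ g n)) (sumBelow-- n f g)) (interchange (sumBelow n f) (sumBelow n g) (f n) (g n))
  where
  interchange : ∀ a b c d → (a -ℤ b) +ℤ (c -ℤ d) ≡ (a +ℤ c) -ℤ (b +ℤ d)
  interchange = solve-∀

sumBelow-*ˡ : ∀ n c (f : ℕ → ℤ) → sumBelow n (λ i → c *ℤ f i) ≡ c *ℤ sumBelow n f
sumBelow-*ˡ zero    c f = sym (ℤ.*-zeroʳ c)
sumBelow-*ˡ (suc n) c f =
  trans (cong (_+ℤ c *ℤ f n) (sumBelow-*ˡ n c f)) (sym (ℤ.*-distribˡ-+ c (sumBelow n f) (f n)))

sumBelow-const : ∀ n c → sumBelow n (λ _ → c) ≡ + n *ℤ c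
sumBelow-const zero    c = sym (ℤ.*-zeroˡ c)
sumBelow-const (suc n) c = trans (cong (_+ℤ c) (sumBelow-const n c)) (step (+ n) c)
  where
  step : ∀ a c → a *ℤ c +ℤ c ≡ (+ 1 +ℤ a) *ℤ c
  step = solve-∀

unique-⊆⇒↭ : ∀ {a} {A : Set a} {xs ys : List A} → Unique xs → All (_∈ ys) xs → length xs ≡ length ys → xs ↭ ys
unique-⊆⇒↭ {xs = []}     {[]}    _ _ _ = ↭.refl
unique-⊆⇒↭ {xs = x ∷ xs} {ys} (x≢xs ∷ xs-unique) (x∈ys ∷ xs⊆ys) length-eq with ∈-∃++ x∈ys
... | as , bs , refl =
  ↭.trans (↭.prep x (unique-⊆⇒↭ xs-unique (All.zipWith remove-x (x≢xs , xs⊆ys)) length-eq′)) (↭.↭-sym (shift x as bs))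
  where
  remove-x : ∀ {y} → x ≢ y × y ∈ as ++ [ x ] ++ bs → y ∈ as ++ bs
  remove-x (x≢y , y∈) with ∈-++⁻ as y∈
  ... | inj₁ y∈as         = ∈-++⁺ˡ y∈as
  ... | inj₂ (here y≡x)   = contradiction (sym y≡x) x≢y
  ... | inj₂ (there y∈bs) = ∈-++⁺ʳ as y∈bs
  length-eq′ : length xs ≡ length (as ++ bs)
  length-eq′ = suc-injective (trans length-eq (↭-length (shift x as bs)))

%≡%⇒∣∸ : ∀ m n d .{{_ : NonZero d}} → m % d ≡ n % d → d ∣ m ∸ n
%≡%⇒∣∸ m n d m≡n = divides (m / d ∸ n / d) (begin
  m ∸ n                                        ≡⟨ cong₂ _∸_ (m≡m%n+[m/n]*n m d) (m≡m%n+[m/n]*n n d) ⟩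
  (m % d + m / d * d) ∸ (n % d + n / d * d)    ≡⟨ cong (λ r → (r + m / d * d) ∸ (n % d + n / d * d)) m≡n ⟩
  (n % d + m / d * d) ∸ (n % d + n / d * d)    ≡⟨ [m+n]∸[m+o]≡n∸o (n % d) _ _ ⟩
  m / d * d ∸ n / d * d                        ≡⟨ *-distribʳ-∸ d (m / d) (n / d) ⟨
  (m / d ∸ n / d) * d                          ∎)
  where open ≡-Reasoning

[1+n]/2≤n : ∀ n → suc n / 2 ≤ n
[1+n]/2≤n n = ≤-pred (m/n<m (suc n) 2 (s≤s (s≤s z≤n)))

σ-fuel-irrelevant : ∀ f g n → n ≤ f → n ≤ g → σ-fuel f n ≡ σ-fuel g n
σ-fuel-irrelevant zero    zero    zero    _         _         = refl
σ-fuel-irrelevant zero    (suc g) zero    _         _         = refl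
σ-fuel-irrelevant (suc f) zero    zero    _         _         = refl
σ-fuel-irrelevant (suc f) (suc g) zero    _         _         = refl
σ-fuel-irrelevant (suc f) (suc g) (suc n) (s≤s n≤f) (s≤s n≤g) =
  cong (_+_ (suc n % 2)) (σ-fuel-irrelevant f g (suc n / 2) (≤-trans ([1+n]/2≤n n) n≤f) (≤-trans ([1+n]/2≤n n) n≤g))

σ-unfold : ∀ n → σ n ≡ n % 2 + σ (n / 2)
σ-unfold zero    = refl
σ-unfold (suc n) = cong (_+_ (suc n % 2)) (σ-fuel-irrelevant n (suc n / 2) (suc n / 2) ([1+n]/2≤n n) ≤-refl)

σ-bit : ∀ {b} q → b < 2 → σ (b + q * 2) ≡ b + σ q
σ-bit {b} q b<2 = begin
  σ (b + q * 2)                           ≡⟨ σ-unfold (b + q * 2) ⟩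
  (b + q * 2) % 2 + σ ((b + q * 2) / 2)   ≡⟨ cong₂ (λ r d → r + σ d) ([m+kn]%n≡m%n b q 2) quotient ⟩
  b % 2 + σ q                             ≡⟨ cong (_+ σ q) (m<n⇒m%n≡m b<2) ⟩
  b + σ q                                 ∎
  where
  open ≡-Reasoning
  quotient : (b + q * 2) / 2 ≡ q
  quotient = begin
    (b + q * 2) / 2       ≡⟨ +-distrib-/-∣ʳ b (n∣m*n q) ⟩
    b / 2 + q * 2 / 2     ≡⟨ cong₂ _+_ (m<n⇒m/n≡0 b<2) (m*n/n≡m q 2) ⟩
    q                     ∎

neg1^-+ : ∀ a b → neg1^ (a + b) ≡ neg1^ a *ℤ neg1^ b
neg1^-+ zero    b = sym (ℤ.*-identityˡ (neg1^ b))
neg1^-+ (suc a) b = trans (cong -_ (neg1^-+ a b)) (ℤ.neg-distribˡ-* (neg1^ a) (neg1^ b))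

tm : ℕ → ℤ
tm n = neg1^ (σ n)

tm-bit : ∀ {b} q → b < 2 → tm (b + q * 2) ≡ neg1^ b *ℤ tm q
tm-bit {b} q b<2 = trans (cong neg1^ (σ-bit q b<2)) (neg1^-+ b (σ q))

tm-block : ∀ j q {r} → r < 2 ^ j → tm (2 ^ j * q + r) ≡ tm q *ℤ tm r
tm-block zero    q {zero} _ = trans (cong tm (trans (+-identityʳ _) (+-identityʳ q))) (sym (ℤ.*-identityʳ (tm q)))
tm-block zero    q {suc r} (s≤s ())
tm-block (suc j) q {r} r<2^[1+j] = begin
  tm (2 ^ suc j * q + r)                   ≡⟨ cong tm digits ⟩
  tm (r % 2 + (2 ^ j * q + r / 2) * 2)     ≡⟨ tm-bit (2 ^ j * q + r / 2) (m%n<n r 2) ⟩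
  neg1^ (r % 2) *ℤ tm (2 ^ j * q + r / 2)  ≡⟨ cong (neg1^ (r % 2) *ℤ_) (tm-block j q r/2<2^j) ⟩
  neg1^ (r % 2) *ℤ (tm q *ℤ tm (r / 2))    ≡⟨ ℤ*.x∙yz≈y∙xz (neg1^ (r % 2)) (tm q) (tm (r / 2)) ⟩
  tm q *ℤ (neg1^ (r % 2) *ℤ tm (r / 2))    ≡⟨ cong (tm q *ℤ_) (tm-bit (r / 2) (m%n<n r 2)) ⟨
  tm q *ℤ tm (r % 2 + r / 2 * 2)           ≡⟨ cong (λ n → tm q *ℤ tm n) (m≡m%n+[m/n]*n r 2) ⟨
  tm q *ℤ tm r                             ∎
  where
  open ≡-Reasoning
  r/2<2^j : r / 2 < 2 ^ j
  r/2<2^j = m<n*o⇒m/o<n (subst (r <_) (*-comm 2 (2 ^ j)) r<2^[1+j])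
  digits : 2 ^ suc j * q + r ≡ r % 2 + (2 ^ j * q + r / 2) * 2
  digits = trans (cong (_+_ (2 ^ suc j * q)) (m≡m%n+[m/n]*n r 2)) (regroup (2 ^ j) q (r % 2) (r / 2))
    where
    regroup : ∀ a q b c → 2 * a * q + (b + c * 2) ≡ b + (a * q + c) * 2
    regroup = ℕ-Solver.solve-∀

tm-2^j+ : ∀ j {r} → r < 2 ^ j → tm (2 ^ j + r) ≡ - tm r
tm-2^j+ j {r} r<2^j = begin
  tm (2 ^ j + r)        ≡⟨ cong (λ k → tm (k + r)) (*-identityʳ (2 ^ j)) ⟨
  tm (2 ^ j * 1 + r)    ≡⟨ tm-block j 1 r<2^j ⟩
  tm 1 *ℤ tm r          ≡⟨ ℤ.-1*i≡-i (tm r) ⟩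
  - tm r                ∎
  where open ≡-Reasoning

-- With (E φ) m = φ (m + 1): Δ ℓ is the operator ∏_{a ∈ ℓ} (1 - E^a), and e s ℓ is the
-- elementary symmetric polynomial e_s(E^a : a ∈ ℓ) (a sum over the s-element sub-multisets of ℓ).
Δ : List ℕ → (ℕ → ℤ) → ℕ → ℤ
Δ []      φ m = φ m
Δ (a ∷ ℓ) φ m = Δ ℓ φ m -ℤ Δ ℓ φ (m + a)

e : ℕ → List ℕ → (ℕ → ℤ) → ℕ → ℤ
e zero    ℓ       φ m = φ m
e (suc s) []      φ m = + 0
e (suc s) (a ∷ ℓ) φ m = e (suc s) ℓ φ m +ℤ e s ℓ φ (m + a)

Δ-expand : ∀ ℓ φ m {N} → length ℓ < N → Δ ℓ φ m ≡ sumBelow N (λ s → neg1^ s *ℤ e s ℓ φ m)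
Δ-expand [] φ m {suc N} _ = begin
  φ m                                                          ≡⟨ ℤ.+-identityʳ (φ m) ⟨
  φ m +ℤ + 0                                                   ≡⟨ cong₂ _+ℤ_ (ℤ.*-identityˡ (φ m)) vanish ⟨
  + 1 *ℤ φ m +ℤ sumBelow N (λ s → neg1^ (suc s) *ℤ + 0)        ≡⟨ sumBelow-suc N _ ⟨
  sumBelow (suc N) (λ s → neg1^ s *ℤ e s [] φ m)               ∎
  where
  open ≡-Reasoning
  vanish : sumBelow N (λ s → neg1^ (suc s) *ℤ + 0) ≡ + 0
  vanish = begin
    sumBelow N (λ s → neg1^ (suc s) *ℤ + 0)  ≡⟨ sumBelow-cong N (λ s _ → ℤ.*-zeroʳ (neg1^ (suc s))) ⟩
    sumBelow N (λ _ → + 0)                   ≡⟨ sumBelow-const N (+ 0) ⟩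
    + N *ℤ + 0                               ≡⟨ ℤ.*-zeroʳ (+ N) ⟩
    + 0                                      ∎
Δ-expand (a ∷ ℓ) φ m {suc N} (s≤s ℓ<N) = begin
  Δ ℓ φ m -ℤ Δ ℓ φ (m + a)
    ≡⟨ cong₂ _-ℤ_ (Δ-expand ℓ φ m (m<n⇒m<1+n ℓ<N)) (Δ-expand ℓ φ (m + a) ℓ<N) ⟩
  sumBelow (suc N) (λ s → neg1^ s *ℤ e s ℓ φ m) -ℤ sumBelow N (λ s → neg1^ s *ℤ e s ℓ φ (m + a))
    ≡⟨ cong (_-ℤ sumBelow N (λ s → neg1^ s *ℤ e s ℓ φ (m + a))) (sumBelow-suc N _) ⟩
  + 1 *ℤ φ m +ℤ sumBelow N (λ s → neg1^ (suc s) *ℤ e (suc s) ℓ φ m) -ℤ sumBelow N (λ s → neg1^ s *ℤ e s ℓ φ (m + a))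
    ≡⟨ ℤ.+-assoc (+ 1 *ℤ φ m) _ _ ⟩
  + 1 *ℤ φ m +ℤ (sumBelow N (λ s → neg1^ (suc s) *ℤ e (suc s) ℓ φ m) -ℤ sumBelow N (λ s → neg1^ s *ℤ e s ℓ φ (m + a)))
    ≡⟨ cong (_+ℤ_ (+ 1 *ℤ φ m)) (sumBelow-- N _ _) ⟨
  + 1 *ℤ φ m +ℤ sumBelow N (λ s → neg1^ (suc s) *ℤ e (suc s) ℓ φ m -ℤ neg1^ s *ℤ e s ℓ φ (m + a))
    ≡⟨ cong (_+ℤ_ (+ 1 *ℤ φ m)) (sumBelow-cong N (λ s _ → distrib (neg1^ s) _ _)) ⟨
  + 1 *ℤ φ m +ℤ sumBelow N (λ s → neg1^ (suc s) *ℤ e (suc s) (a ∷ ℓ) φ m)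
    ≡⟨ sumBelow-suc N _ ⟨
  sumBelow (suc N) (λ s → neg1^ s *ℤ e s (a ∷ ℓ) φ m)
    ∎
  where
  open ≡-Reasoning
  distrib : ∀ u x y → (- u) *ℤ (x +ℤ y) ≡ (- u) *ℤ x -ℤ u *ℤ y
  distrib = solve-∀

e-↭ : ∀ s {ℓ ℓ′} → ℓ ↭ ℓ′ → ∀ φ m → e s ℓ φ m ≡ e s ℓ′ φ m
e-↭ s       ↭.refl          φ m = refl
e-↭ zero    (↭.prep x ℓ↭ℓ′) φ m = refl
e-↭ (suc s) (↭.prep x ℓ↭ℓ′) φ m = cong₂ _+ℤ_ (e-↭ (suc s) ℓ↭ℓ′ φ m) (e-↭ s ℓ↭ℓ′ φ (m + x))
e-↭ zero    (↭.swap x y ℓ↭ℓ′) φ m = refl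
e-↭ (suc zero) {_ ∷ _ ∷ ℓ} {_ ∷ _ ∷ ℓ′} (↭.swap x y ℓ↭ℓ′) φ m =
  trans (cong (λ t → t +ℤ φ (m + y) +ℤ φ (m + x)) (e-↭ 1 ℓ↭ℓ′ φ m)) (ℤ+.xy∙z≈xz∙y (e 1 ℓ′ φ m) _ _)
e-↭ (suc (suc s)) {_ ∷ _ ∷ ℓ} {_ ∷ _ ∷ ℓ′} (↭.swap x y ℓ↭ℓ′) φ m = begin
  e (2 + s) ℓ φ m +ℤ e (suc s) ℓ φ (m + y) +ℤ (e (suc s) ℓ φ (m + x) +ℤ e s ℓ φ (m + x + y))
    ≡⟨ cong₂ (λ u v → u +ℤ e (suc s) ℓ φ (m + y) +ℤ (e (suc s) ℓ φ (m + x) +ℤ v))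
             (e-↭ (2 + s) ℓ↭ℓ′ φ m) (cong (e s ℓ φ) (ℕ+.xy∙z≈xz∙y m x y)) ⟩
  e (2 + s) ℓ′ φ m +ℤ e (suc s) ℓ φ (m + y) +ℤ (e (suc s) ℓ φ (m + x) +ℤ e s ℓ φ (m + y + x))
    ≡⟨ ℤ+.interchange (e (2 + s) ℓ′ φ m) _ _ _ ⟩
  e (2 + s) ℓ′ φ m +ℤ e (suc s) ℓ φ (m + x) +ℤ (e (suc s) ℓ φ (m + y) +ℤ e s ℓ φ (m + y + x))
    ≡⟨ cong₂ (λ u v → e (2 + s) ℓ′ φ m +ℤ u +ℤ v)
             (e-↭ (suc s) ℓ↭ℓ′ φ (m + x))
             (cong₂ _+ℤ_ (e-↭ (suc s) ℓ↭ℓ′ φ (m + y)) (e-↭ s ℓ↭ℓ′ φ (m + y + x))) ⟩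
  e (2 + s) ℓ′ φ m +ℤ e (suc s) ℓ′ φ (m + x) +ℤ (e (suc s) ℓ′ φ (m + y) +ℤ e s ℓ′ φ (m + y + x))
    ∎
  where open ≡-Reasoning
e-↭ s       (↭.trans ℓ↭ℓ′ ℓ′↭ℓ″) φ m = trans (e-↭ s ℓ↭ℓ′ φ m) (e-↭ s ℓ′↭ℓ″ φ m)

Δ-cong-e : ∀ {ℓ ℓ′ φ ψ m} → length ℓ′ ≤ length ℓ → (∀ s → e s ℓ φ m ≡ e s ℓ′ ψ m) → Δ ℓ φ m ≡ Δ ℓ′ ψ m
Δ-cong-e {ℓ} {ℓ′} {φ} {ψ} {m} ℓ′≤ℓ e≡e = begin
  Δ ℓ φ m                                                  ≡⟨ Δ-expand ℓ φ m ≤-refl ⟩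
  sumBelow (suc (length ℓ)) (λ s → neg1^ s *ℤ e s ℓ φ m)   ≡⟨ sumBelow-cong (suc (length ℓ)) (λ s _ → cong (neg1^ s *ℤ_) (e≡e s)) ⟩
  sumBelow (suc (length ℓ)) (λ s → neg1^ s *ℤ e s ℓ′ ψ m)  ≡⟨ Δ-expand ℓ′ ψ m (s≤s ℓ′≤ℓ) ⟨
  Δ ℓ′ ψ m                                                 ∎
  where open ≡-Reasoning

Δ-↭ : ∀ {ℓ ℓ′} → ℓ ↭ ℓ′ → ∀ φ m → Δ ℓ φ m ≡ Δ ℓ′ φ m
Δ-↭ ℓ↭ℓ′ φ m = Δ-cong-e (≤-reflexive (↭-length (↭.↭-sym ℓ↭ℓ′))) (λ s → e-↭ s ℓ↭ℓ′ φ m)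

e-map-suc : ∀ s ℓ φ m → e s (map suc ℓ) φ m ≡ e s ℓ φ (m + s)
e-map-suc zero    ℓ       φ m = cong φ (sym (+-identityʳ m))
e-map-suc (suc s) []      φ m = refl
e-map-suc (suc s) (a ∷ ℓ) φ m =
  cong₂ _+ℤ_ (e-map-suc (suc s) ℓ φ m) (trans (e-map-suc s ℓ φ (m + suc a)) (cong (e s ℓ φ) (exchange m a s)))
  where
  exchange : ∀ m a s → m + suc a + s ≡ m + suc s + a
  exchange = ℕ-Solver.solve-∀

tm-sum≡Δ : ∀ j φ m → sumBelow (2 ^ j) (λ r → tm r *ℤ φ (m + r)) ≡ Δ (applyDownFrom (2 ^_) j) φ m
tm-sum≡Δ zero    φ m = trans (ℤ.+-identityˡ _) (trans (ℤ.*-identityˡ _) (cong φ (+-identityʳ m)))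
tm-sum≡Δ (suc j) φ m = begin
  sumBelow (2 ^ suc j) f
    ≡⟨ cong (λ n → sumBelow (2 ^ j + n) f) (+-identityʳ (2 ^ j)) ⟩
  sumBelow (2 ^ j + 2 ^ j) f
    ≡⟨ sumBelow-+ (2 ^ j) (2 ^ j) f ⟩
  sumBelow (2 ^ j) f +ℤ sumBelow (2 ^ j) (λ r → tm (2 ^ j + r) *ℤ φ (m + (2 ^ j + r)))
    ≡⟨ cong (_+ℤ_ (sumBelow (2 ^ j) f)) (sumBelow-cong (2 ^ j) upper-half) ⟩
  sumBelow (2 ^ j) f +ℤ sumBelow (2 ^ j) (λ r → - (tm r *ℤ φ (m + 2 ^ j + r)))
    ≡⟨ cong (_+ℤ_ (sumBelow (2 ^ j) f)) (sumBelow-neg (2 ^ j) _) ⟩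
  sumBelow (2 ^ j) f -ℤ sumBelow (2 ^ j) (λ r → tm r *ℤ φ (m + 2 ^ j + r))
    ≡⟨ cong₂ _-ℤ_ (tm-sum≡Δ j φ m) (tm-sum≡Δ j φ (m + 2 ^ j)) ⟩
  Δ (applyDownFrom (2 ^_) j) φ m -ℤ Δ (applyDownFrom (2 ^_) j) φ (m + 2 ^ j)
    ∎
  where
  open ≡-Reasoning
  f : ℕ → ℤ
  f r = tm r *ℤ φ (m + r)
  upper-half : ∀ r → r < 2 ^ j → tm (2 ^ j + r) *ℤ φ (m + (2 ^ j + r)) ≡ - (tm r *ℤ φ (m + 2 ^ j + r))
  upper-half r r<2^j = trans (cong₂ _*ℤ_ (tm-2^j+ j r<2^j) (cong φ (sym (+-assoc m (2 ^ j) r))))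
                             (sym (ℤ.neg-distribˡ-* (tm r) _))

Period : ℕ → (ℕ → ℤ) → Set
Period a φ = ∀ m → φ (m + a) ≡ φ m

module _ {a} {φ : ℕ → ℤ} (a-period : Period a φ) where

  period-* : ∀ k m → φ (m + k * a) ≡ φ m
  period-* zero    m = cong φ (+-identityʳ m)
  period-* (suc k) m = begin
    φ (m + (a + k * a))  ≡⟨ cong φ (ℕ+.x∙yz≈xz∙y m a (k * a)) ⟩
    φ (m + k * a + a)    ≡⟨ a-period (m + k * a) ⟩
    φ (m + k * a)        ≡⟨ period-* k m ⟩
    φ m                  ∎
    where open ≡-Reasoning

  period-+ : ∀ b → Period a (λ m → φ (m + b))
  period-+ b m = trans (cong φ (ℕ+.xy∙z≈xz∙y m a b)) (a-period (m + b))

  period-% : .{{_ : NonZero a}} → ∀ m b → φ (m + b) ≡ φ (m + b % a)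
  period-% m b = begin
    φ (m + b)                     ≡⟨ cong (λ c → φ (m + c)) (m≡m%n+[m/n]*n b a) ⟩
    φ (m + (b % a + b / a * a))   ≡⟨ cong φ (sym (+-assoc m (b % a) (b / a * a))) ⟩
    φ (m + b % a + b / a * a)     ≡⟨ period-* (b / a) (m + b % a) ⟩
    φ (m + b % a)                 ∎
    where open ≡-Reasoning

period-1⇒constant : ∀ {φ : ℕ → ℤ} → Period 1 φ → ∀ m → φ m ≡ φ 0
period-1⇒constant         one-period zero    = refl
period-1⇒constant {φ = φ} one-period (suc m) =
  trans (cong φ (+-comm 1 m)) (trans (one-period m) (period-1⇒constant one-period m))

module _ {a b} {φ : ℕ → ℤ} (a-period : Period a φ) (b-period : Period b φ) where

  Bézout⇒period-1 : ∀ x y → 1 + y * b ≡ x * a → Period 1 φ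
  Bézout⇒period-1 x y 1+yb≡xa m = begin
    φ (m + 1)            ≡⟨ period-* b-period y (m + 1) ⟨
    φ (m + 1 + y * b)    ≡⟨ cong φ (trans (+-assoc m 1 (y * b)) (cong (_+_ m) 1+yb≡xa)) ⟩
    φ (m + x * a)        ≡⟨ period-* a-period x m ⟩
    φ m                  ∎
    where open ≡-Reasoning

coprime-periods⇒constant : ∀ {a b} {φ : ℕ → ℤ} → Coprime a b → Period a φ → Period b φ → ∀ m → φ m ≡ φ 0
coprime-periods⇒constant coprime a-period b-period with coprime-Bézout coprime
... | Bézout.+- x y eq = period-1⇒constant (Bézout⇒period-1 a-period b-period x y eq)
... | Bézout.-+ x y eq = period-1⇒constant (Bézout⇒period-1 b-period a-period y x eq)

e-period : ∀ {a} s ℓ {φ} → Period a φ → Period a (e s ℓ φ)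
e-period zero    ℓ       φ-period     = φ-period
e-period (suc s) []      φ-period m   = refl
e-period (suc s) (b ∷ ℓ) φ-period m   =
  cong₂ _+ℤ_ (e-period (suc s) ℓ φ-period m) (period-+ (e-period s ℓ φ-period) b m)

Δ-period : ∀ {a} ℓ {φ} → Period a φ → Period a (Δ ℓ φ)
Δ-period []      φ-period m = φ-period m
Δ-period (b ∷ ℓ) φ-period m = cong₂ _-ℤ_ (Δ-period ℓ φ-period m) (period-+ (Δ-period ℓ φ-period) b m)

module _ {p} .{{_ : NonZero p}} {φ : ℕ → ℤ} (p-period : Period p φ) where

  e-map-% : ∀ s ℓ m → e s (map (_% p) ℓ) φ m ≡ e s ℓ φ m
  e-map-% zero    ℓ       m = refl
  e-map-% (suc s) []      m = refl
  e-map-% (suc s) (a ∷ ℓ) m = cong₂ _+ℤ_ (e-map-% (suc s) ℓ m)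
    (trans (e-map-% s ℓ (m + a % p)) (sym (period-% (e-period s ℓ p-period) m a)))

  Δ-map-% : ∀ ℓ m → Δ (map (_% p) ℓ) φ m ≡ Δ ℓ φ m
  Δ-map-% ℓ m = Δ-cong-e (≤-reflexive (sym (length-map (_% p) ℓ))) (λ s → e-map-% s ℓ m)

δ : ℕ → ℕ → ℤ
δ p m = if does (p ∣? m) then + 1 else + 0

δ-period : ∀ p → Period p (δ p)
δ-period p m with p ∣? m + p | p ∣? m
... | yes _      | yes _   = refl
... | no  _      | no  _   = refl
... | yes p∣m+p  | no  p∤m = contradiction (∣m+n∣m⇒∣n (subst (p ∣_) (+-comm m p) p∣m+p) ∣-refl) p∤m
... | no  p∤m+p  | yes p∣m = contradiction (∣m∣n⇒∣m+n p∣m ∣-refl) p∤m+p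

newman-summand : ∀ p n → (if does (p ∣? n) then neg1^ (σ n) else + 0) ≡ tm n *ℤ δ p n
newman-summand p n with p ∣? n
... | yes _ = sym (ℤ.*-identityʳ (tm n))
... | no  _ = sym (ℤ.*-zeroʳ (tm n))

S-block : ∀ p j x → S p (2 ^ j * suc x) ≡ S p (2 ^ j * x) +ℤ tm x *ℤ Δ (applyDownFrom (2 ^_) j) (δ p) (2 ^ j * x)
S-block p j x = begin
  S p (2 ^ j * suc x)                                      ≡⟨ cong (S p) (trans (*-suc (2 ^ j) x) (+-comm (2 ^ j) M)) ⟩
  S p (M + 2 ^ j)                                          ≡⟨ sumBelow-+ M (2 ^ j) _ ⟩
  S p M +ℤ sumBelow (2 ^ j) (λ r → summand (M + r))        ≡⟨ cong (_+ℤ_ (S p M)) (sumBelow-cong (2 ^ j) factor) ⟩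
  S p M +ℤ sumBelow (2 ^ j) (λ r → tm x *ℤ (tm r *ℤ δ p (M + r)))
                                                           ≡⟨ cong (_+ℤ_ (S p M)) (sumBelow-*ˡ (2 ^ j) (tm x) _) ⟩
  S p M +ℤ tm x *ℤ sumBelow (2 ^ j) (λ r → tm r *ℤ δ p (M + r))
                                                           ≡⟨ cong (λ t → S p M +ℤ tm x *ℤ t) (tm-sum≡Δ j (δ p) M) ⟩
  S p M +ℤ tm x *ℤ Δ (applyDownFrom (2 ^_) j) (δ p) M      ∎
  where
  open ≡-Reasoning
  M : ℕ
  M = 2 ^ j * x
  summand : ℕ → ℤ
  summand n = if does (p ∣? n) then neg1^ (σ n) else + 0
  factor : ∀ r → r < 2 ^ j → summand (M + r) ≡ tm x *ℤ (tm r *ℤ δ p (M + r))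
  factor r r<2^j = begin
    summand (M + r)                  ≡⟨ newman-summand p (M + r) ⟩
    tm (M + r) *ℤ δ p (M + r)        ≡⟨ cong (_*ℤ δ p (M + r)) (tm-block j x r<2^j) ⟩
    tm x *ℤ tm r *ℤ δ p (M + r)      ≡⟨ ℤ.*-assoc (tm x) (tm r) _ ⟩
    tm x *ℤ (tm r *ℤ δ p (M + r))    ∎

module _ {n} {φ : ℕ → ℤ} (φ-period : Period (suc n) φ) where

  -- Adding 1 to each of 0, …, n permutes them modulo suc n.
  e-downFrom-period : ∀ s → Period s (e s (downFrom (suc n)) φ)
  e-downFrom-period s m = begin
    e s (downFrom (suc n)) φ (m + s)                      ≡⟨ e-map-suc s (downFrom (suc n)) φ m ⟨
    e s (map suc (downFrom (suc n))) φ m                  ≡⟨ cong (λ ℓ → e s ℓ φ m) (map-downFrom suc (suc n)) ⟩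
    e s (suc n ∷ applyDownFrom suc n) φ m                 ≡⟨ e-map-% φ-period s (suc n ∷ applyDownFrom suc n) m ⟨
    e s (suc n % suc n ∷ map (_% suc n) (applyDownFrom suc n)) φ m
                                                          ≡⟨ cong (λ r → e s (r ∷ map (_% suc n) (applyDownFrom suc n)) φ m) (n%n≡0 (suc n)) ⟩
    e s (map (_% suc n) (0 ∷ applyDownFrom suc n)) φ m    ≡⟨ e-map-% φ-period s (0 ∷ applyDownFrom suc n) m ⟩
    e s (0 ∷ applyDownFrom suc n) φ m                     ≡⟨ e-↭ s (∷↭∷ʳ 0 (applyDownFrom suc n)) φ m ⟩
    e s (applyDownFrom suc n ∷ʳ 0) φ m                    ≡⟨ cong (λ ℓ → e s ℓ φ m) (downFrom-∷ʳ n) ⟩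
    e s (downFrom (suc n)) φ m                            ∎
    where open ≡-Reasoning

  e-complement : Prime (suc n) → ∀ {s} → suc s < suc n → ∀ m →
                 e (suc s) (applyDownFrom suc n) φ m ≡ e (suc s) (downFrom (suc n)) φ 0 -ℤ e s (applyDownFrom suc n) φ m
  e-complement p-prime {s} s+1<p m = begin
    e (suc s) R φ m                                        ≡⟨ add-sub (e (suc s) R φ m) (e s R φ m) ⟩
    e (suc s) R φ m +ℤ e s R φ m -ℤ e s R φ m               ≡⟨ cong (_-ℤ e s R φ m) split-zero ⟨
    e (suc s) (downFrom (suc n)) φ m -ℤ e s R φ m           ≡⟨ cong (_-ℤ e s R φ m) constant ⟩
    e (suc s) (downFrom (suc n)) φ 0 -ℤ e s R φ m           ∎
    where
    open ≡-Reasoning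
    R : List ℕ
    R = applyDownFrom suc n
    add-sub : ∀ x y → x ≡ x +ℤ y -ℤ y
    add-sub = solve-∀
    split-zero : e (suc s) (downFrom (suc n)) φ m ≡ e (suc s) R φ m +ℤ e s R φ m
    split-zero = begin
      e (suc s) (downFrom (suc n)) φ m  ≡⟨ cong (λ ℓ → e (suc s) ℓ φ m) (downFrom-∷ʳ n) ⟨
      e (suc s) (R ∷ʳ 0) φ m            ≡⟨ e-↭ (suc s) (∷↭∷ʳ 0 R) φ m ⟨
      e (suc s) R φ m +ℤ e s R φ (m + 0) ≡⟨ cong (λ k → e (suc s) R φ m +ℤ e s R φ k) (+-identityʳ m) ⟩
      e (suc s) R φ m +ℤ e s R φ m      ∎
    constant : e (suc s) (downFrom (suc n)) φ m ≡ e (suc s) (downFrom (suc n)) φ 0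
    constant = coprime-periods⇒constant (prime⇒coprime p-prime s+1<p)
                 (e-period (suc s) (downFrom (suc n)) φ-period) (e-downFrom-period (suc s)) m

Δ-units : ∀ {n} → Prime (suc n) → ∀ m m′ →
          Δ (applyDownFrom suc n) (δ (suc n)) m -ℤ Δ (applyDownFrom suc n) (δ (suc n)) m′
          ≡ + suc n *ℤ (δ (suc n) m -ℤ δ (suc n) m′)
Δ-units {n} p-prime m m′ = begin
  Δ R δₚ m -ℤ Δ R δₚ m′
    ≡⟨ cong₂ _-ℤ_ (Δ-expand R δₚ m length<p) (Δ-expand R δₚ m′ length<p) ⟩
  sumBelow (suc n) (λ s → term s m) -ℤ sumBelow (suc n) (λ s → term s m′)
    ≡⟨ sumBelow-- (suc n) _ _ ⟨
  sumBelow (suc n) (λ s → term s m -ℤ term s m′)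
    ≡⟨ sumBelow-cong (suc n) (λ s s<p → term-difference s s<p) ⟩
  sumBelow (suc n) (λ _ → δₚ m -ℤ δₚ m′)
    ≡⟨ sumBelow-const (suc n) _ ⟩
  + suc n *ℤ (δₚ m -ℤ δₚ m′)
    ∎
  where
  open ≡-Reasoning
  R : List ℕ
  R = applyDownFrom suc n
  δₚ : ℕ → ℤ
  δₚ = δ (suc n)
  length<p : length R < suc n
  length<p = s≤s (≤-reflexive (length-applyDownFrom suc n))
  term : ℕ → ℕ → ℤ
  term s m = neg1^ s *ℤ e s R δₚ m
  term-difference : ∀ s → s < suc n → term s m -ℤ term s m′ ≡ δₚ m -ℤ δₚ m′
  term-difference zero    _   = cong₂ _-ℤ_ (ℤ.*-identityˡ (δₚ m)) (ℤ.*-identityˡ (δₚ m′))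
  term-difference (suc s) s<p = begin
    - u *ℤ e (suc s) R δₚ m -ℤ - u *ℤ e (suc s) R δₚ m′
      ≡⟨ cong₂ (λ a b → - u *ℤ a -ℤ - u *ℤ b) (complement m) (complement m′) ⟩
    - u *ℤ (K -ℤ e s R δₚ m) -ℤ - u *ℤ (K -ℤ e s R δₚ m′)
      ≡⟨ cancel u K (e s R δₚ m) (e s R δₚ m′) ⟩
    term s m -ℤ term s m′
      ≡⟨ term-difference s (m<n⇒m<1+n (≤-pred s<p)) ⟩
    δₚ m -ℤ δₚ m′
      ∎
    where
    u = neg1^ s
    K = e (suc s) (downFrom (suc n)) δₚ 0
    complement : ∀ k → e (suc s) R δₚ k ≡ K -ℤ e s R δₚ k
    complement = e-complement (δ-period (suc n)) p-prime s<p
    cancel : ∀ u K y y′ → - u *ℤ (K -ℤ y) -ℤ - u *ℤ (K -ℤ y′) ≡ u *ℤ y -ℤ u *ℤ y′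
    cancel = solve-∀

module _ {n} (p-prime : Prime (suc n)) (fermat : suc n ∣ 2 ^ n ∸ 1) where

  2^n∸1+1 : 2 ^ n ∸ 1 + 1 ≡ 2 ^ n
  2^n∸1+1 = m∸n+n≡m (m^n>0 2 n)

  2^n%p≡1 : 2 ^ n % suc n ≡ 1
  2^n%p≡1 = begin
    2 ^ n % suc n             ≡⟨ cong (_% suc n) 2^n∸1+1 ⟨
    (2 ^ n ∸ 1 + 1) % suc n   ≡⟨ %-remove-+ˡ 1 fermat ⟩
    1 % suc n                 ≡⟨ m<n⇒m%n≡m (nonTrivial⇒n>1 (suc n) {{prime⇒nonTrivial p-prime}}) ⟩
    1                         ∎
    where open ≡-Reasoning

  p∤2^i : ∀ {i} → i ≤ n → ¬ suc n ∣ 2 ^ i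
  p∤2^i {i} i≤n p∣2^i = nonTrivial⇒≢1 {{prime⇒nonTrivial p-prime}} (∣1⇒≡1 p∣1)
    where
    p∣2^n : suc n ∣ 2 ^ n
    p∣2^n = subst (suc n ∣_) (trans (sym (^-distribˡ-+-* 2 i (n ∸ i))) (cong (2 ^_) (m+[n∸m]≡n i≤n)))
                  (∣-trans p∣2^i (m∣m*n (2 ^ (n ∸ i))))
    p∣1 : suc n ∣ 1
    p∣1 = ∣m+n∣m⇒∣n (subst (suc n ∣_) (sym 2^n∸1+1) p∣2^n) fermat

  2^i%p∈units : ∀ {i} → i < n → 2 ^ i % suc n ∈ applyDownFrom suc n
  2^i%p∈units {i} i<n with 2 ^ i % suc n in r≡
  ... | zero  = contradiction (m%n≡0⇒n∣m (2 ^ i) (suc n) r≡) (p∤2^i (<⇒≤ i<n))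
  ... | suc k = ∈-applyDownFrom⁺ suc (≤-pred (subst (_< suc n) r≡ (m%n<n (2 ^ i) (suc n))))

  module _ (2-primitive : ∀ k → 0 < k → k < n → ¬ suc n ∣ 2 ^ k ∸ 1) where

    2^i%p-injective : ∀ {i j} → j < i → i < n → 2 ^ i % suc n ≢ 2 ^ j % suc n
    2^i%p-injective {i} {j} j<i i<n 2^i≡2^j
      with euclidsLemma (2 ^ j) (2 ^ (i ∸ j) ∸ 1) p-prime p∣2^j[2^[i-j]-1]
      where
      p∣2^j[2^[i-j]-1] : suc n ∣ 2 ^ j * (2 ^ (i ∸ j) ∸ 1)
      p∣2^j[2^[i-j]-1] = subst (suc n ∣_) factor (%≡%⇒∣∸ (2 ^ i) (2 ^ j) (suc n) 2^i≡2^j)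
        where
        factor : 2 ^ i ∸ 2 ^ j ≡ 2 ^ j * (2 ^ (i ∸ j) ∸ 1)
        factor = begin
          2 ^ i ∸ 2 ^ j                        ≡⟨ cong (λ k → 2 ^ k ∸ 2 ^ j) (m+[n∸m]≡n (<⇒≤ j<i)) ⟨
          2 ^ (j + (i ∸ j)) ∸ 2 ^ j            ≡⟨ cong₂ _∸_ (^-distribˡ-+-* 2 j (i ∸ j)) (sym (*-identityʳ (2 ^ j))) ⟩
          2 ^ j * 2 ^ (i ∸ j) ∸ 2 ^ j * 1      ≡⟨ *-distribˡ-∸ (2 ^ j) (2 ^ (i ∸ j)) 1 ⟨
          2 ^ j * (2 ^ (i ∸ j) ∸ 1)            ∎
          where open ≡-Reasoning
    ... | inj₁ p∣2^j   = p∤2^i (<⇒≤ (<-trans j<i i<n)) p∣2^j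
    ... | inj₂ p∣2^k-1 = 2-primitive (i ∸ j) (m<n⇒0<n∸m j<i) (≤-<-trans (m∸n≤m i j) i<n) p∣2^k-1

    powers-of-2↭units : map (_% suc n) (applyDownFrom (2 ^_) n) ↭ applyDownFrom suc n
    powers-of-2↭units = unique-⊆⇒↭ unique contained lengths
      where
      residues≡ : map (_% suc n) (applyDownFrom (2 ^_) n) ≡ applyDownFrom (λ i → 2 ^ i % suc n) n
      residues≡ = map-applyDownFrom (2 ^_) (_% suc n) n
      unique : Unique (map (_% suc n) (applyDownFrom (2 ^_) n))
      unique = subst Unique (sym residues≡) (Uniqueₚ.applyDownFrom⁺₁ _ n 2^i%p-injective)
      contained : All (_∈ applyDownFrom suc n) (map (_% suc n) (applyDownFrom (2 ^_) n))
      contained = subst (All (_∈ applyDownFrom suc n)) (sym residues≡) (Allₚ.applyDownFrom⁺₁ _ n 2^i%p∈units)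
      lengths : length (map (_% suc n) (applyDownFrom (2 ^_) n)) ≡ length (applyDownFrom suc n)
      lengths = trans (length-map (_% suc n) (applyDownFrom (2 ^_) n))
                      (trans (length-applyDownFrom (2 ^_) n) (sym (length-applyDownFrom suc n)))

    Δ-powers-of-2≡p*Δ[1] : ∀ m → Δ (applyDownFrom (2 ^_) (suc n)) (δ (suc n)) m
                                 ≡ + suc n *ℤ Δ [ 1 ] (δ (suc n)) m
    Δ-powers-of-2≡p*Δ[1] m = begin
      Δ (2 ^ n ∷ P) δₚ m                            ≡⟨ Δ-map-% (δ-period (suc n)) (2 ^ n ∷ P) m ⟨
      Δ (2 ^ n % suc n ∷ map (_% suc n) P) δₚ m     ≡⟨ cong (λ r → Δ (r ∷ map (_% suc n) P) δₚ m) 2^n%p≡1 ⟩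
      Δ (1 ∷ map (_% suc n) P) δₚ m                 ≡⟨ Δ-↭ (↭.prep 1 powers-of-2↭units) δₚ m ⟩
      Δ (1 ∷ applyDownFrom suc n) δₚ m              ≡⟨ Δ-units p-prime m (m + 1) ⟩
      + suc n *ℤ Δ [ 1 ] δₚ m                       ∎
      where
      open ≡-Reasoning
      P : List ℕ
      P = applyDownFrom (2 ^_) n
      δₚ : ℕ → ℤ
      δₚ = δ (suc n)

    Δ[1][2^p*x]≡Δ[1][2*x] : ∀ x → Δ [ 1 ] (δ (suc n)) (2 ^ suc n * x) ≡ Δ [ 1 ] (δ (suc n)) (2 * x)
    Δ[1][2^p*x]≡Δ[1][2*x] x =
      trans (cong (Δ [ 1 ] (δ (suc n))) 2^p*x≡2x+kp) (period-* (Δ-period [ 1 ] (δ-period (suc n))) (2 * k * x) (2 * x))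
      where
      open _∣_ fermat renaming (quotient to k; equality to 2^n∸1≡kp)
      2^p*x≡2x+kp : 2 ^ suc n * x ≡ 2 * x + 2 * k * x * suc n
      2^p*x≡2x+kp = begin
        2 * 2 ^ n * x                ≡⟨ cong (λ t → 2 * t * x) (trans (sym 2^n∸1+1) (cong (_+ 1) 2^n∸1≡kp)) ⟩
        2 * (k * suc n + 1) * x      ≡⟨ expand k (suc n) x ⟩
        2 * x + 2 * k * x * suc n    ∎
        where
        open ≡-Reasoning
        expand : ∀ k p x → 2 * (k * p + 1) * x ≡ 2 * x + 2 * k * x * p
        expand = ℕ-Solver.solve-∀

    S[2^p*x]≡p*S[2*x] : ∀ x → S (suc n) (2 ^ suc n * x) ≡ + suc n *ℤ S (suc n) (2 * x)
    S[2^p*x]≡p*S[2*x] zero    = trans (cong (S (suc n)) (*-zeroʳ (2 ^ suc n))) (sym (ℤ.*-zeroʳ (+ suc n)))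
    S[2^p*x]≡p*S[2*x] (suc x) = begin
      S p (2 ^ p * suc x)
        ≡⟨ S-block p p x ⟩
      S p (2 ^ p * x) +ℤ tm x *ℤ Δ (applyDownFrom (2 ^_) p) (δ p) (2 ^ p * x)
        ≡⟨ cong₂ (λ a b → a +ℤ tm x *ℤ b) (S[2^p*x]≡p*S[2*x] x) (Δ-powers-of-2≡p*Δ[1] (2 ^ p * x)) ⟩
      + p *ℤ S p (2 * x) +ℤ tm x *ℤ (+ p *ℤ Δ [ 1 ] (δ p) (2 ^ p * x))
        ≡⟨ cong (λ b → + p *ℤ S p (2 * x) +ℤ tm x *ℤ (+ p *ℤ b)) (Δ[1][2^p*x]≡Δ[1][2*x] x) ⟩
      + p *ℤ S p (2 * x) +ℤ tm x *ℤ (+ p *ℤ Δ [ 1 ] (δ p) (2 * x))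
        ≡⟨ factor-out (+ p) (S p (2 * x)) (tm x) _ ⟩
      + p *ℤ (S p (2 * x) +ℤ tm x *ℤ Δ [ 1 ] (δ p) (2 * x))
        ≡⟨ cong (+ p *ℤ_) (S-block p 1 x) ⟨
      + p *ℤ S p (2 * suc x)
        ∎
      where
      open ≡-Reasoning
      p : ℕ
      p = suc n
      factor-out : ∀ a s t d → a *ℤ s +ℤ t *ℤ (a *ℤ d) ≡ a *ℤ (s +ℤ t *ℤ d)
      factor-out = solve-∀

theorem1 : (p : ℕ) → Prime p → IsPrimitiveRoot2 p →
    (x : ℕ) → S p (2 ^ p * x) ≡ (+ p) *ℤ S p (2 * x)
theorem1 zero    p-prime = contradiction p-prime ¬prime[0]
theorem1 (suc n) p-prime (fermat , 2-primitive) = S[2^p*x]≡p*S[2*x] p-prime fermat 2-primitive
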